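{- Let $P=(\mathcal{S},\vec{T}_U,\vec{T}_Q)$ and $P'=(\mathcal{S}',\vec{T}_U',\vec{T}_Q')$ be database-driven programs with $|\vec T_U'|\ge|\vec T_U|$ and $|\vec T_Q'|\ge|\vec T_Q|$. Suppose an oracle is available for proving any valid Hoare triple and any valid logical entailment (so that inductiveness and projective sufficiency are understood semantically). If $P'\preceq P$, then there exists a projectively sufficient and inductive simulation invariant $\Phi$ for $P$ and $P'$.
   Context: A database-driven program is a triple $P=(\mathcal{S},\vec{T}_U,\vec{T}_Q)$. The schema $\mathcal{S}$ maps finitely many relation names $R$ to record types $\{a_1:\tau_1;\dots;a_n:\tau_n\}$. $\vec{T}_U=(U_1,\dots,U_m)$ is a list of update transactions $\lambda\vec v.\,U$ and $\vec{T}_Q=(Q_1,\dots,Q_l)$ a list of query transactions $\lambda\vec v.\,Q$, with $U ::= \mathtt{ins}(R,\{a_1:v_1,\dots,a_n:v_n\}) \mid \mathtt{del}(R,\phi)\mid \mathtt{upd}(R,\phi,a,v)\mid U;U$, $Q ::= R\mid \Pi_\psi(Q)\mid \sigma_\phi(Q)\mid Q\bowtie_\phi Q\mid Q\cup Q\mid Q-Q$, where $\psi$ is a nonempty list of attributes, $\phi$ is a boolean combination ($\wedge,\vee,\neg$) of atoms $a\odot a'$, $a\odot v$, $a\in Q$ with $\odot\in\{\le,<,=,\ne,>,\ge\}$, and $v$ ranges over parameter variables and constants. A database instance $\Delta$ maps each relation name to a finite list of tuples; a tuple is a finite map from attribute names to values, viewed as a list of (attribute, value) pairs. A valuation $\sigma$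 maps parameter variables to values; $v[\sigma]$ is the value of $v$. Semantics of updates: $[\![U_1;U_2]\!]_{\sigma,\Delta}=[\![U_2]\!]_{\sigma,[\![U_1]\!]_{\sigma,\Delta}}$; $\mathtt{ins}(R,t)$ appends the tuple $t[\sigma]$ to the end of $\Delta(R)$; $\mathtt{del}(R,\phi)$ replaces $\Delta(R)$ by the sublist (order preserved) of tuples $x$ with $[\![\phi]\!]_{\sigma,\Delta,x}$ false; $\mathtt{upd}(R,\phi,a,v)$ replaces $\Delta(R)$ by the list of tuples not satisfying $\phi$ (in order) followed by the list of tuples satisfying $\phi$ (in order), each with attribute $a$ set to $v[\sigma]$. Semantics of queries: $[\![R]\!]_{\sigma,\Delta}=\Delta(R)$; $\Pi_\psi$ restricts each tuple to the attributes in $\psi$; $\sigma_\phi$ keeps the tuples $x$ with $[\![\phi]\!]_{\sigma,\Delta,x}$ true; $Q_1\times Q_2$ lists, for each $y$ of $[\![Q_1]\!]$ in order and each $z$ of $[\![Q_2]\!]$ in order, the merged map $y\cup z$ (keys disjoint); $Q_1\bowtie_\phi Q_2=\sigma_\phi(Q_1\times Q_2)$; $\cup$ is list concatenation; $Q_1-Q_2$ starts from $[\![Q_1]\!]$ and, for each element $y$ of $[\![Q_2]\!]$ in order, deletes the first occurrence of $y$ (if any). Predicates on a tuple $x$: $a\odot a'$ compares $x(a),x(a')$; $a\odot v$ compares $x(a)$ with $v[\sigma]$; $a\in Q$ holds iff $x(a)$ occurs in the list of first values of the tuples of $[\![Q]\!]_{\sigma,\Delta}$; connectives are standard. An invocation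 sequence is $\omega=(i_1,\sigma_1);\dots;(i_n,\sigma_n)$, $n\ge1$, where for $j<n$, $i_j$ is the index of an update transaction and $\sigma_j$ a valuation of its parameters, and $i_n$ is the index of a query transaction with valuation $\sigma_n$. $[\![P]\!]_{\omega,\Delta}$ is obtained by applying $U_{i_1}$ under $\sigma_1$ to $\Delta$, then $U_{i_2}$ under $\sigma_2$, etc., yielding $\Delta''$, and returning the list obtained by mapping each tuple of $[\![Q_{i_n}]\!]_{\sigma_n,\Delta''}$ to its list of values. $[\![P]\!]_\omega=[\![P]\!]_{\omega,\Delta_\emptyset}$ where $\Delta_\emptyset$ maps every relation to the empty list. Refinement: for each shared index $i$, the parameters $\vec x=(x_1,\dots,x_k)$ of the $i$-th transaction of $P$ correspond to the first $k$ parameters $y_1,\dots,y_k$ of the $i$-th transaction of $P'$ (which may have more parameters). A valuation $\sigma'$ refines $\sigma$, $\sigma'\preceq\sigma$, if $\sigma'$ gives every variable of $\mathrm{dom}(\sigma)$ (i.e. each $y_j$ corresponding to $x_j$) the same value as $\sigma$. For invocation sequences $\omega=(i_1,\sigma_1)\dots(i_n,\sigma_n)$ (valid for $P$) and $\omega'=(i'_1,\sigma'_1)\dots(i'_n,\sigma'_n)$ (valid for $P'$), $\omega'\preceq\omega$ iff $i_k=i'_k$ and $\sigma'_k\preceq\sigma_k$ for all $k\in[1,n]$. $P'\preceq P$ iff for all such $\omega,\omega'$ with $\omega'\preceq\omega$ there is an attribute list $L$ with $[\![\Pi_L(P')]\!]_{\omega'}=[\![P]\!]_\omega$, where $\Pi_L(P')$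 replaces each query $Q'_i$ of $P'$ by $\Pi_L(Q'_i)$. A simulation invariant is a relation $\Phi$ between instances of $\mathcal{S}$ and of $\mathcal{S}'$. It is inductive if (a) $\Phi(\Delta_\emptyset,\Delta'_\emptyset)$ and (b) for every $i\in[1,|\vec T_U|]$ the Hoare triple $\{\Phi\wedge\bigwedge_{x_j\in\vec x}x_j=y_j\}\,U_i;U_i'\,\{\Phi\}$ is valid (with $\vec x$ the parameters of $U_i$, $\vec y$ those of $U'_i$). It is projectively sufficient if for every $i\in[1,|\vec T_Q|]$, $(\Phi\wedge\bigwedge_{x_j\in\vec x}x_j=y_j)\models\exists L.\ Q_i=\Pi_L(Q'_i)$, i.e. whenever $\Phi(\Delta,\Delta')$ and the valuations agree on corresponding parameters, there is an attribute list $L$ such that the value lists of $[\![Q_i]\!]$ on $\Delta$ and $[\![\Pi_L(Q'_i)]\!]$ on $\Delta'$ coincide. -}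

module Defs where

open import Data.Nat using (ℕ; _≡ᵇ_; _≤ᵇ_; _<ᵇ_; _≤_)
open import Data.Bool using (Bool; true; false; _∧_; _∨_; not; if_then_else_)
open import Data.List using (List; []; _∷_; _++_; [_]; map; concatMap; foldl; length; lookup; zip)
open import Data.List.NonEmpty using (List⁺; toList)
open import Data.List.Relation.Unary.All using (All)
open import Data.List.Relation.Binary.Pointwise using (Pointwise)
open import Data.Maybe using (Maybe; just; nothing)
open import Data.Product using (_×_; _,_; proj₁; proj₂; Σ)
open import Data.Fin using (Fin; toℕ; inject≤)
open import Relation.Binary.PropositionalEquality using (_≡_)

Value : Set
Value = ℕ

Attr : Set
Attr = ℕ

RelName : Set
RelName = ℕ

Var : Set
Var = ℕ

-- attribute types (only one base type, since values are ℕ)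
data Ty : Set where
  tnat : Ty

Schema : Set
Schema = List (RelName × List (Attr × Ty))

data Val : Set where
  var   : Var → Val
  const : Value → Val

data Op : Set where
  le lt eq ne gt ge : Op

data Query : Set
data Pred : Set

data Query where
  rel   : RelName → Query
  proj  : List⁺ Attr → Query → Query
  sel   : Pred → Query → Query
  join  : Pred → Query → Query → Query
  union : Query → Query → Query
  diff  : Query → Query → Query

data Pred where
  cmpAA : Attr → Op → Attr → Pred
  cmpAV : Attr → Op → Val → Pred
  inQ   : Attr → Query → Pred
  andP  : Pred → Pred → Pred
  orP   : Pred → Pred → Pred
  notP  : Pred → Pred

data Update : Set where
  ins : RelName → List (Attr × Val) → Update
  del : RelName → Pred → Update
  upd : RelName → Pred → Attr → Val → Update
  seq : Update → Update → Update

Tuple : Set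
Tuple = List (Attr × Value)

Instance : Set
Instance = RelName → List Tuple

emptyInst : Instance
emptyInst _ = []

Valuation : Set
Valuation = Var → Value

val : Valuation → Val → Value
val σ (var x)   = σ x
val σ (const c) = c

look : Attr → Tuple → Maybe Value
look a [] = nothing
look a ((b , v) ∷ t) = if a ≡ᵇ b then just v else look a t

cmpOp : Op → Value → Value → Bool
cmpOp le m n = m ≤ᵇ n
cmpOp lt m n = m <ᵇ n
cmpOp eq m n = m ≡ᵇ n
cmpOp ne m n = not (m ≡ᵇ n)
cmpOp gt m n = n <ᵇ m
cmpOp ge m n = n ≤ᵇ m

cmp : Op → Maybe Value → Maybe Value → Bool
cmp o (just m) (just n) = cmpOp o m n
cmp o _ _ = false

filterB : {A : Set} → (A → Bool) → List A → List A
filterB p [] = []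
filterB p (x ∷ xs) = if p x then x ∷ filterB p xs else filterB p xs

anyB : {A : Set} → (A → Bool) → List A → Bool
anyB p [] = false
anyB p (x ∷ xs) = p x ∨ anyB p xs

firstIs : Value → Tuple → Bool
firstIs v [] = false
firstIs v ((_ , w) ∷ _) = v ≡ᵇ w

memFirst : Maybe Value → List Tuple → Bool
memFirst nothing  ts = false
memFirst (just v) ts = anyB (firstIs v) ts

restrict : List Attr → Tuple → Tuple
restrict ψ x = concatMap (λ a → f a (look a x)) ψ
  where
  f : Attr → Maybe Value → Tuple
  f a (just v) = [ (a , v) ]
  f a nothing  = []

-- Cartesian product, merging tuples (keys disjoint)
cross : List Tuple → List Tuple → List Tuple
cross ys zs = concatMap (λ y → map (λ z → y ++ z) zs) ys

eqTuple : Tuple → Tuple → Bool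
eqTuple [] [] = true
eqTuple ((a , v) ∷ t) ((b , w) ∷ u) = (a ≡ᵇ b) ∧ ((v ≡ᵇ w) ∧ eqTuple t u)
eqTuple _ _ = false

deleteFirst : Tuple → List Tuple → List Tuple
deleteFirst y [] = []
deleteFirst y (z ∷ zs) = if eqTuple y z then zs else z ∷ deleteFirst y zs

minus : List Tuple → List Tuple → List Tuple
minus xs ys = foldl (λ acc y → deleteFirst y acc) xs ys

evalQ : Valuation → Instance → Query → List Tuple
evalP : Valuation → Instance → Pred → Tuple → Bool

evalQ σ Δ (rel R)        = Δ R
evalQ σ Δ (proj ψ q)     = map (restrict (toList ψ)) (evalQ σ Δ q)
evalQ σ Δ (sel φ q)      = filterB (evalP σ Δ φ) (evalQ σ Δ q)
evalQ σ Δ (join φ q₁ q₂) = filterB (evalP σ Δ φ) (cross (evalQ σ Δ q₁) (evalQ σ Δ q₂))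
evalQ σ Δ (union q₁ q₂)  = evalQ σ Δ q₁ ++ evalQ σ Δ q₂
evalQ σ Δ (diff q₁ q₂)   = minus (evalQ σ Δ q₁) (evalQ σ Δ q₂)

evalP σ Δ (cmpAA a o b) x = cmp o (look a x) (look b x)
evalP σ Δ (cmpAV a o v) x = cmp o (look a x) (just (val σ v))
evalP σ Δ (inQ a q)     x = memFirst (look a x) (evalQ σ Δ q)
evalP σ Δ (andP φ ψ)    x = evalP σ Δ φ x ∧ evalP σ Δ ψ x
evalP σ Δ (orP φ ψ)     x = evalP σ Δ φ x ∨ evalP σ Δ ψ x
evalP σ Δ (notP φ)      x = not (evalP σ Δ φ x)

setRel : Instance → RelName → List Tuple → Instance
setRel Δ R ts S = if S ≡ᵇ R then ts else Δ S

setAttr : Attr → Value → Tuple → Tuple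
setAttr a v [] = [ (a , v) ]
setAttr a v ((b , w) ∷ t) = if a ≡ᵇ b then (b , v) ∷ t else (b , w) ∷ setAttr a v t

runU : Valuation → Instance → Update → Instance
runU σ Δ (ins R t) = setRel Δ R (Δ R ++ [ map (λ p → proj₁ p , val σ (proj₂ p)) t ])
runU σ Δ (del R φ) = setRel Δ R (filterB (λ x → not (evalP σ Δ φ x)) (Δ R))
runU σ Δ (upd R φ a v) =
  setRel Δ R (filterB (λ x → not (evalP σ Δ φ x)) (Δ R)
              ++ map (setAttr a (val σ v)) (filterB (evalP σ Δ φ) (Δ R)))
runU σ Δ (seq u₁ u₂) = runU σ (runU σ Δ u₁) u₂

record UTrans : Set where
  field
    params : List Var
    body   : Update

record QTrans : Set where
  field
    params : List Var
    body   : Query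

record Program : Set where
  field
    schema  : Schema
    updates : List UTrans
    queries : List QTrans

open Program public

NU : Program → ℕ
NU P = length (updates P)

NQ : Program → ℕ
NQ P = length (queries P)

UT : (P : Program) → Fin (NU P) → UTrans
UT P i = lookup (updates P) i

QT : (P : Program) → Fin (NQ P) → QTrans
QT P i = lookup (queries P) i

record Invocation (P : Program) : Set where
  field
    calls : List (Fin (NU P) × Valuation)
    final : Fin (NQ P) × Valuation

open Invocation public

applyCalls : (P : Program) → Instance → List (Fin (NU P) × Valuation) → Instance
applyCalls P Δ cs = foldl (λ Δ' c → runU (proj₂ c) Δ' (UTrans.body (UT P (proj₁ c)))) Δ cs

values : List Tuple → List (List Value)
values = map (map proj₂)

runProg : (P : Program) → Invocation P → List (List Value)
runProg P ω =
  values (evalQ (proj₂ (final ω)) (applyCalls P emptyInst (calls ω))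
                (QTrans.body (QT P (proj₁ (final ω)))))

runProgProj : (P : Program) → List⁺ Attr → Invocation P → List (List Value)
runProgProj P L ω =
  values (evalQ (proj₂ (final ω)) (applyCalls P emptyInst (calls ω))
                (proj L (QTrans.body (QT P (proj₁ (final ω))))))

Agree : List Var → List Var → Valuation → Valuation → Set
Agree xs ys σ σ' = All (λ p → σ (proj₁ p) ≡ σ' (proj₂ p)) (zip xs ys)

RefinesInv : (P P' : Program) → Invocation P' → Invocation P → Set
RefinesInv P P' ω' ω =
  Pointwise (λ c' c → (toℕ (proj₁ c') ≡ toℕ (proj₁ c))
                    × Agree (UTrans.params (UT P (proj₁ c))) (UTrans.params (UT P' (proj₁ c')))
                            (proj₂ c) (proj₂ c'))
            (calls ω') (calls ω)
  × (toℕ (proj₁ (final ω')) ≡ toℕ (proj₁ (final ω)))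
  × Agree (QTrans.params (QT P (proj₁ (final ω)))) (QTrans.params (QT P' (proj₁ (final ω'))))
          (proj₂ (final ω)) (proj₂ (final ω'))

Refines : (P' P : Program) → Set
Refines P' P = (ω : Invocation P) (ω' : Invocation P') → RefinesInv P P' ω' ω →
  Σ (List⁺ Attr) (λ L → runProgProj P' L ω' ≡ runProg P ω)

-- Simulation invariants (semantic: oracle for Hoare triples / entailments)

SimInv : Set₁
SimInv = Instance → Instance → Set

Inductive : (P P' : Program) → NU P ≤ NU P' → SimInv → Set
Inductive P P' hU Φ =
  Φ emptyInst emptyInst
  × ((i : Fin (NU P)) (Δ Δ' : Instance) (σ σ' : Valuation) →
      Φ Δ Δ' →
      Agree (UTrans.params (UT P i)) (UTrans.params (UT P' (inject≤ i hU))) σ σ' →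
      Φ (runU σ Δ (UTrans.body (UT P i)))
        (runU σ' Δ' (UTrans.body (UT P' (inject≤ i hU)))))

ProjSufficient : (P P' : Program) → NQ P ≤ NQ P' → SimInv → Set
ProjSufficient P P' hQ Φ =
  (i : Fin (NQ P)) (Δ Δ' : Instance) (σ σ' : Valuation) →
  Φ Δ Δ' →
  Agree (QTrans.params (QT P i)) (QTrans.params (QT P' (inject≤ i hQ))) σ σ' →
  Σ (List⁺ Attr) (λ L →
    values (evalQ σ Δ (QTrans.body (QT P i)))
      ≡ values (evalQ σ' Δ' (proj L (QTrans.body (QT P' (inject≤ i hQ))))))

module Submission where

open import Defs
open import Data.Nat using (_≤_)
open import Data.Product using (Σ; _×_; _,_; proj₁; proj₂)
open import Data.List using (List; []; _++_; [_])
open import Data.List.Properties using (foldl-++)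
open import Data.List.Relation.Binary.Pointwise using (Pointwise; []; _∷_; ++⁺)
open import Data.Fin using (Fin; toℕ; inject≤)
open import Data.Fin.Properties using (toℕ-inject≤)
open import Relation.Binary.PropositionalEquality using (_≡_; refl; sym)

-- The invariant is joint reachability: Δ and Δ' are the results of running
-- related update-call prefixes of P and P' from the empty instances.  A related
-- update call extends both prefixes, so the invariant is inductive; a related
-- query call completes them to related invocation sequences, on which P' ⪯ P
-- provides the projection list, so it is projectively sufficient.

Call : Program → Set
Call P = Fin (NU P) × Valuation

applyCalls-∷ʳ : (P : Program) (Δ : Instance) (cs : List (Call P)) (c : Call P) →
  applyCalls P Δ (cs ++ [ c ]) ≡ runU (proj₂ c) (applyCalls P Δ cs) (UTrans.body (UT P (proj₁ c)))
applyCalls-∷ʳ P Δ cs c = foldl-++ _ Δ cs [ c ]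

module _ (P P' : Program) where

  RelatedCall : Call P' → Call P → Set
  RelatedCall c' c = (toℕ (proj₁ c') ≡ toℕ (proj₁ c))
                   × Agree (UTrans.params (UT P (proj₁ c))) (UTrans.params (UT P' (proj₁ c')))
                           (proj₂ c) (proj₂ c')

  JointlyReachable : SimInv
  JointlyReachable Δ Δ' = Σ (List (Call P)) λ cs → Σ (List (Call P')) λ cs' →
    Pointwise RelatedCall cs' cs
    × (Δ ≡ applyCalls P emptyInst cs)
    × (Δ' ≡ applyCalls P' emptyInst cs')

  jointlyReachable-inductive : (hU : NU P ≤ NU P') → Inductive P P' hU JointlyReachable
  jointlyReachable-inductive hU = ([] , [] , [] , refl , refl) , step
    where
    step : (i : Fin (NU P)) (Δ Δ' : Instance) (σ σ' : Valuation) →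
      JointlyReachable Δ Δ' →
      Agree (UTrans.params (UT P i)) (UTrans.params (UT P' (inject≤ i hU))) σ σ' →
      JointlyReachable (runU σ Δ (UTrans.body (UT P i)))
                       (runU σ' Δ' (UTrans.body (UT P' (inject≤ i hU))))
    step i _ _ σ σ' (cs , cs' , related , refl , refl) agree =
      cs ++ [ c ] , cs' ++ [ c' ] ,
      ++⁺ related ((toℕ-inject≤ i hU , agree) ∷ []) ,
      sym (applyCalls-∷ʳ P emptyInst cs c) ,
      sym (applyCalls-∷ʳ P' emptyInst cs' c')
      where
      c  = (i , σ)
      c' = (inject≤ i hU , σ')

  jointlyReachable-projSufficient : (hQ : NQ P ≤ NQ P') → Refines P' P →
    ProjSufficient P P' hQ JointlyReachable
  jointlyReachable-projSufficient hQ refines i _ _ σ σ' (cs , cs' , related , refl , refl) agree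
    with refines ω ω' (related , toℕ-inject≤ i hQ , agree)
    where
    ω : Invocation P
    ω = record { calls = cs ; final = (i , σ) }
    ω' : Invocation P'
    ω' = record { calls = cs' ; final = (inject≤ i hQ , σ') }
  ... | L , same = L , sym same

theorem4p8 : (P P' : Program) (hU : NU P ≤ NU P') (hQ : NQ P ≤ NQ P') →
    Refines P' P →
    Σ SimInv (λ Φ → Inductive P P' hU Φ × ProjSufficient P P' hQ Φ)
theorem4p8 P P' hU hQ refines =
  JointlyReachable P P' ,
  jointlyReachable-inductive P P' hU ,
  jointlyReachable-projSufficient P P' hQ refines
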